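{- Let $G$ be a finite simple graph. Then $\check s(G)=2$ if and only if $G$ is a non-regular graph which is the union of two edge-disjoint regular Class 1 graphs $H_1$ and $H_2$ satisfying $V(H_1)\subseteq V(H_2)$.
   Context: A graph $H$ is Class 1 if its chromatic index equals its maximum degree. For a proper edge coloring $\varphi$ of a graph $G$, the palette of a vertex $v$ is the set of colors on edges incident with $v$. The palette index $\check s(G)$ is the minimum number of distinct palettes over all proper edge colorings of $G$. -}

module Defs where

open import Data.Nat using (ℕ; zero; suc; _+_; _≤_; _<_)
open import Data.Fin using (Fin)
open import Data.Bool using (Bool; true; false; if_then_else_)
open import Data.List using (List; map)
open import Data.Nat.ListAction using (sum)
open import Data.List.Base using (allFin)
open import Data.Product using (Σ; ∃; _×_; _,_)
open import Data.Sum using (_⊎_)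
open import Relation.Binary.PropositionalEquality using (_≡_; _≢_)
open import Relation.Nullary using (¬_)
open import Function.Bundles using (_⇔_)
open import Function.Definitions using (Injective; Surjective)

record Graph (n : ℕ) : Set where
  field
    adj    : Fin n → Fin n → Bool
    sym    : ∀ u v → adj u v ≡ adj v u
    irrefl : ∀ v → adj v v ≡ false
open Graph public

Adj : ∀ {n} → Graph n → Fin n → Fin n → Set
Adj G u v = adj G u v ≡ true

degree : ∀ {n} → Graph n → Fin n → ℕ
degree {n} G v = sum (map (λ u → if adj G v u then 1 else 0) (allFin n))

Regular : ∀ {n} → Graph n → Set
Regular {n} G = ∃ λ r → ∀ v → degree G v ≡ r

-- Δ(G) = d  (with Δ = 0 for the graph with no vertices)
MaxDegree : ∀ {n} → Graph n → ℕ → Set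
MaxDegree G d = (∀ v → degree G v ≤ d) × (d ≡ 0 ⊎ ∃ λ v → degree G v ≡ d)

-- A proper edge colouring with colours in ℕ: c u v is the colour of edge uv
-- (values on non-edges are irrelevant).
ProperEdgeColoring : ∀ {n} → Graph n → (Fin n → Fin n → ℕ) → Set
ProperEdgeColoring G c =
  (∀ u v → Adj G u v → c u v ≡ c v u) ×
  (∀ u v w → Adj G u v → Adj G u w → v ≢ w → c u v ≢ c u w)

UsesColoursBelow : ∀ {n} → Graph n → (Fin n → Fin n → ℕ) → ℕ → Set
UsesColoursBelow G c k = ∀ u v → Adj G u v → c u v < k

ChromaticIndex : ∀ {n} → Graph n → ℕ → Set
ChromaticIndex G k =
  (∃ λ c → ProperEdgeColoring G c × UsesColoursBelow G c k) ×
  (∀ j c → ProperEdgeColoring G c → UsesColoursBelow G c j → k ≤ j)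

Class1 : ∀ {n} → Graph n → Set
Class1 G = ∃ λ k → ChromaticIndex G k × MaxDegree G k

InPalette : ∀ {n} → Graph n → (Fin n → Fin n → ℕ) → Fin n → ℕ → Set
InPalette G c v k = ∃ λ w → Adj G v w × c v w ≡ k

SamePalette : ∀ {n} → Graph n → (Fin n → Fin n → ℕ) → Fin n → Fin n → Set
SamePalette G c u v = ∀ k → InPalette G c u k ⇔ InPalette G c v k

-- c has exactly k distinct palettes: there is a surjective labelling of the
-- vertices by Fin k whose fibres are exactly the palette classes.
HasPaletteCount : ∀ {n} → Graph n → (Fin n → Fin n → ℕ) → ℕ → Set
HasPaletteCount {n} G c k =
  Σ (Fin n → Fin k) λ f → Surjective _≡_ _≡_ f ×
    (∀ u v → (f u ≡ f v) ⇔ SamePalette G c u v)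

PaletteIndex : ∀ {n} → Graph n → ℕ → Set
PaletteIndex G k =
  (∃ λ c → ProperEdgeColoring G c × HasPaletteCount G c k) ×
  (∀ c j → ProperEdgeColoring G c → HasPaletteCount G c j → k ≤ j)

-- G is the union of edge-disjoint H₁, H₂ where V(H₁) ⊆ V(H₂) = V(G);
-- H₁ lives on Fin m and is embedded by the injection ι.
IsEdgeDisjointUnion : ∀ {n m} → Graph n → Graph m → (Fin m → Fin n) → Graph n → Set
IsEdgeDisjointUnion G H₁ ι H₂ =
  (∀ a b → Adj H₁ a b → adj H₂ (ι a) (ι b) ≡ false) ×
  (∀ u v → Adj G u v ⇔
     ((∃ λ a → ∃ λ b → ι a ≡ u × ι b ≡ v × Adj H₁ a b) ⊎ Adj H₂ u v))

module Submission where

-- Everything turns on *range palettes*: the palette of v is exactly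
-- {0, …, k-1}.  Counting duplicate-free palette lists shows that a range
-- palette {0, …, k-1} forces degree k, and that a vertex of degree k whose
-- colours are all below k has that range palette.  Hence a graph is regular
-- Class 1 iff some colouring gives every vertex the same range palette, and a
-- non-regular graph needs at least two palettes.
--
-- (⇐) Colour H₂ with the common range {0, …, k₂-1} and H₁ with its range
-- shifted up by k₂: vertices of H₁ see {0, …, k₂+k₁-1}, the others
-- {0, …, k₂-1}.  As G is not regular, these are exactly two palettes.
-- (⇒) Renumber an optimal colouring (common colours first, then each class's
-- private colours) so that the two palettes become ranges p and q, which
-- differ by minimality; so G is not regular.  If p < q, the edges coloured
-- below p form a spanning p-regular Class 1 graph H₂, and the others join the
-- vertices with range q, forming, after subtracting p from every colour, a
-- (q ∸ p)-regular Class 1 graph H₁.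

open import Defs
open import Data.Nat using (ℕ; zero; suc; _+_; _∸_; _≤_; _<_; z≤n; s≤s)
open import Data.Fin using (Fin)
open import Data.Product using (Σ; ∃; _×_)
open import Relation.Nullary using (¬_)
open import Function.Bundles using (_⇔_)
open import Function.Definitions using (Injective; Surjective)
open import Relation.Binary.PropositionalEquality using (_≡_)

import Data.Nat as ℕ
import Data.Nat.Properties as ℕ
import Data.Fin as Fin
import Data.Fin.Properties as Fin
open import Data.Bool using (true; false; if_then_else_)
import Data.Bool as Bool
open import Data.Nat.ListAction using (sum)
import Data.List.Relation.Unary.All as All
import Data.List.Relation.Unary.All.Properties as All
open import Data.List.Relation.Unary.AllPairs using ([]; _∷_)
open import Data.List using (List; []; _∷_; map; length; lookup; upTo; filter)
open import Data.List.Base using (allFin)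
open import Data.List.Properties using (length-map; length-upTo)
open import Data.List.Relation.Unary.Any as Any using (here; there)
open import Data.List.Relation.Unary.Any.Properties using (lookup-index)
open import Data.List.Relation.Unary.Unique.Propositional using (Unique)
import Data.List.Relation.Unary.Unique.Propositional.Properties as Unique
open import Data.List.Membership.Propositional using (_∈_)
open import Data.List.Membership.Propositional.Properties
  using (∈-map⁺; ∈-map⁻; ∈-upTo⁺; ∈-upTo⁻; ∈-filter⁺; ∈-filter⁻; ∈-lookup; ∈-allFin)
open import Data.List.Membership.DecPropositional ℕ._≟_ using (_∈?_)
open import Data.List.Relation.Binary.Subset.Propositional using (_⊆_)
open import Data.Product using (_,_; proj₁; proj₂)
open import Data.Sum using (_⊎_; inj₁; inj₂)
open import Data.Empty using (⊥-elim)
open import Relation.Binary.PropositionalEquality using (_≢_; refl; trans; cong; subst; module ≡-Reasoning)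
import Relation.Binary.PropositionalEquality as ≡
open import Relation.Binary using (Tri; tri<; tri≈; tri>)
open import Relation.Nullary using (Dec; yes; no; does; ¬?; _×-dec_; map′)
open import Relation.Nullary.Decidable using (dec-true; dec-false; does-≡)
open import Function.Bundles using (mk⇔; Equivalence)
open Equivalence using (to; from)
import Function.Properties.Equivalence as ⇔

Adj-sym : ∀ {n} (G : Graph n) {u v} → Adj G u v → Adj G v u
Adj-sym G {u} {v} u~v = trans (Graph.sym G v u) u~v

lookup-injective : ∀ {A : Set} {xs : List A} → Unique xs →
                   ∀ i j → lookup xs i ≡ lookup xs j → i ≡ j
lookup-injective {xs = _ ∷ _}  _ Fin.zero Fin.zero _ = refl
lookup-injective {xs = _ ∷ xs} u Fin.zero (Fin.suc j) eq =
  ⊥-elim (Unique.Unique[x∷xs]⇒x∉xs u (subst (_∈ xs) (≡.sym eq) (∈-lookup j)))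
lookup-injective {xs = _ ∷ xs} u (Fin.suc i) Fin.zero eq =
  ⊥-elim (Unique.Unique[x∷xs]⇒x∉xs u (subst (_∈ xs) eq (∈-lookup i)))
lookup-injective (_ ∷ u) (Fin.suc i) (Fin.suc j) eq = cong Fin.suc (lookup-injective u i j eq)

-- A duplicate-free list contained in another list is at most as long:
-- sending each position of xs to a position of the same entry in ys is injective.
unique-⊆⇒length-≤ : ∀ {A : Set} {xs ys : List A} → Unique xs → xs ⊆ ys → length xs ≤ length ys
unique-⊆⇒length-≤ {xs = xs} {ys} u xs⊆ys = Fin.injective⇒≤ {f = place} place-injective
  where
  place : Fin (length xs) → Fin (length ys)
  place i = Any.index (xs⊆ys (∈-lookup i))

  place-injective : Injective _≡_ _≡_ place
  place-injective {i} {j} eq = lookup-injective u i j (begin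
    lookup xs i          ≡⟨ lookup-index (xs⊆ys (∈-lookup i)) ⟩
    lookup ys (place i)  ≡⟨ cong (lookup ys) eq ⟩
    lookup ys (place j)  ≡⟨ lookup-index (xs⊆ys (∈-lookup j)) ⟨
    lookup xs j          ∎)
    where open ≡-Reasoning

map-unique : ∀ {A B : Set} {f : A → B} {xs : List A} →
  (∀ {x y} → x ∈ xs → y ∈ xs → f x ≡ f y → x ≡ y) → Unique xs → Unique (map f xs)
map-unique {xs = []} _ _ = []
map-unique {xs = x ∷ xs} inj (x∉xs ∷ u) =
  All.map⁺ (All.tabulate λ y∈xs fx≡fy → All.lookup x∉xs y∈xs (inj (here refl) (there y∈xs) fx≡fy))
  ∷ map-unique (λ x∈ y∈ → inj (there x∈) (there y∈)) u

offset-< : ∀ {i a b} → a ≤ i → i < a + b → i ∸ a < b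
offset-< {i} {a} {b} a≤i i< = ℕ.+-cancelˡ-< a _ _ (subst (_< a + b) (≡.sym (ℕ.m+[n∸m]≡n a≤i)) i<)

-- rank x xs is the position of the first occurrence of x in xs
-- (an arbitrary value when x does not occur).
rank : ℕ → List ℕ → ℕ
rank x [] = 0
rank x (y ∷ ys) with x ℕ.≟ y
... | yes _ = 0
... | no _  = suc (rank x ys)

rank-< : ∀ {x xs} → x ∈ xs → rank x xs < length xs
rank-< {x} {y ∷ ys} x∈ with x ℕ.≟ y
... | yes _ = s≤s z≤n
rank-< (here x≡y)   | no x≢y = ⊥-elim (x≢y x≡y)
rank-< (there x∈ys) | no _   = s≤s (rank-< x∈ys)

rank-injective : ∀ {x y xs} → x ∈ xs → y ∈ xs → rank x xs ≡ rank y xs → x ≡ y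
rank-injective {x} {y} {z ∷ zs} x∈ y∈ eq with x ℕ.≟ z | y ℕ.≟ z
... | yes x≡z | yes y≡z = trans x≡z (≡.sym y≡z)
rank-injective (here x≡z)   _            _  | no x≢z | no _   = ⊥-elim (x≢z x≡z)
rank-injective (there _)    (here y≡z)   _  | no _   | no y≢z = ⊥-elim (y≢z y≡z)
rank-injective (there x∈zs) (there y∈zs) eq | no _   | no _   =
  rank-injective x∈zs y∈zs (ℕ.suc-injective eq)

rank-surjective : ∀ {xs} → Unique xs → ∀ {i} → i < length xs → ∃ λ x → x ∈ xs × rank x xs ≡ i
rank-surjective {y ∷ ys} _ {zero} _ = y , here refl , rank-head
  where
  rank-head : rank y (y ∷ ys) ≡ 0
  rank-head with y ℕ.≟ y
  ... | yes _  = refl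
  ... | no y≢y = ⊥-elim (y≢y refl)
rank-surjective {y ∷ ys} u {suc i} (s≤s i<) with rank-surjective (Unique.drop⁺ 1 u) i<
... | x , x∈ys , rank≡i = x , there x∈ys , trans rank-cons (cong suc rank≡i)
  where
  rank-cons : rank x (y ∷ ys) ≡ suc (rank x ys)
  rank-cons with x ℕ.≟ y
  ... | yes refl = ⊥-elim (Unique.Unique[x∷xs]⇒x∉xs u x∈ys)
  ... | no _     = refl

record RenumbersOnto (S : ℕ → Set) (g : ℕ → ℕ) (k : ℕ) : Set where
  field
    bounded   : ∀ {x} → S x → g x < k
    injective : ∀ {x y} → S x → S y → g x ≡ g y → x ≡ y
    onto      : ∀ {i} → i < k → ∃ λ x → S x × g x ≡ i

renumbers-resp : ∀ {S T g k} → (∀ x → S x ⇔ T x) → RenumbersOnto T g k → RenumbersOnto S g k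
renumbers-resp S⇔T r = record
  { bounded   = λ s → bounded (to (S⇔T _) s)
  ; injective = λ s s′ → injective (to (S⇔T _) s) (to (S⇔T _) s′)
  ; onto      = λ i< → let x , t , gx≡i = onto i< in x , from (S⇔T x) t , gx≡i }
  where open RenumbersOnto r

two-block-renumbering : ∀ {C D : List ℕ} {g : ℕ → ℕ} → Unique C → Unique D →
  (∀ {x} → x ∈ C → g x ≡ rank x C) → (∀ {x} → x ∈ D → g x ≡ length C + rank x D) →
  RenumbersOnto (λ x → x ∈ C ⊎ x ∈ D) g (length C + length D)
two-block-renumbering {C} {D} {g} uC uD g-C g-D = record
  { bounded = bounded ; injective = injective ; onto = onto }
  where
  below : ∀ {x} → x ∈ C → g x < length C
  below x∈C = subst (_< length C) (≡.sym (g-C x∈C)) (rank-< x∈C)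

  above : ∀ {x} → x ∈ D → length C ≤ g x
  above x∈D = subst (length C ≤_) (≡.sym (g-D x∈D)) (ℕ.m≤m+n (length C) _)

  separated : ∀ {x y} → x ∈ C → y ∈ D → g x ≢ g y
  separated x∈C y∈D gx≡gy = ℕ.<-irrefl refl (ℕ.<-≤-trans (below x∈C) (subst (length C ≤_) (≡.sym gx≡gy) (above y∈D)))

  bounded : ∀ {x} → x ∈ C ⊎ x ∈ D → g x < length C + length D
  bounded (inj₁ x∈C) = ℕ.<-≤-trans (below x∈C) (ℕ.m≤m+n (length C) (length D))
  bounded (inj₂ x∈D) = subst (_< length C + length D) (≡.sym (g-D x∈D)) (ℕ.+-monoʳ-< (length C) (rank-< x∈D))

  injective : ∀ {x y} → x ∈ C ⊎ x ∈ D → y ∈ C ⊎ y ∈ D → g x ≡ g y → x ≡ y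
  injective (inj₁ x∈C) (inj₁ y∈C) eq = rank-injective x∈C y∈C (trans (≡.sym (g-C x∈C)) (trans eq (g-C y∈C)))
  injective (inj₂ x∈D) (inj₂ y∈D) eq =
    rank-injective x∈D y∈D (ℕ.+-cancelˡ-≡ (length C) _ _ (trans (≡.sym (g-D x∈D)) (trans eq (g-D y∈D))))
  injective (inj₁ x∈C) (inj₂ y∈D) eq = ⊥-elim (separated x∈C y∈D eq)
  injective (inj₂ x∈D) (inj₁ y∈C) eq = ⊥-elim (separated y∈C x∈D (≡.sym eq))

  onto : ∀ {i} → i < length C + length D → ∃ λ x → (x ∈ C ⊎ x ∈ D) × g x ≡ i
  onto {i} i< with i ℕ.<? length C
  ... | yes i<C = let x , x∈C , rank≡i = rank-surjective uC i<C
                  in x , inj₁ x∈C , trans (g-C x∈C) rank≡i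
  ... | no i≮C  = let x , x∈D , gx≡ = onto-D (offset-< C≤i i<)
                  in x , inj₂ x∈D , trans gx≡ (ℕ.m+[n∸m]≡n C≤i)
    where
    C≤i : length C ≤ i
    C≤i = ℕ.≮⇒≥ i≮C
    onto-D : ∀ {j} → j < length D → ∃ λ x → x ∈ D × g x ≡ length C + j
    onto-D j< = let x , x∈D , rank≡j = rank-surjective uD j<
                in x , x∈D , trans (g-D x∈D) (cong (length C +_) rank≡j)

RangePalette : ∀ {n} → Graph n → (Fin n → Fin n → ℕ) → Fin n → ℕ → Set
RangePalette G c v k = ∀ i → InPalette G c v i ⇔ i < k

range-bound : ∀ {n} {G : Graph n} {c v w k} → RangePalette G c v k → Adj G v w → c v w < k
range-bound rng v~w = to (rng _) (_ , v~w , refl)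

range-palettes-same⇔ : ∀ {n} {G : Graph n} {c u v a b} →
  RangePalette G c u a → RangePalette G c v b → SamePalette G c u v ⇔ (a ≡ b)
range-palettes-same⇔ {G = G} {c} {u} {v} {a} {b} rng-u rng-v = mk⇔ ranges-equal same
  where
  ranges-equal : SamePalette G c u v → a ≡ b
  ranges-equal sp = ℕ.≤-antisym (ℕ.≮⇒≥ λ b<a → ℕ.<-irrefl refl (to (rng-v b) (to (sp b) (from (rng-u b) b<a))))
                                (ℕ.≮⇒≥ λ a<b → ℕ.<-irrefl refl (to (rng-u a) (from (sp a) (from (rng-v a) a<b))))
  same : a ≡ b → SamePalette G c u v
  same refl i = ⇔.trans (rng-u i) (⇔.sym (rng-v i))

recolour-proper : ∀ {n} {G : Graph n} {c g} → ProperEdgeColoring G c →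
  (∀ u {x y} → InPalette G c u x → InPalette G c u y → g x ≡ g y → x ≡ y) →
  ProperEdgeColoring G (λ u v → g (c u v))
recolour-proper {g = g} (symmetric , distinct) g-inj =
  (λ u v u~v → cong g (symmetric u v u~v)) ,
  (λ u v w u~v u~w v≢w eq → distinct u v w u~v u~w v≢w (g-inj u (v , u~v , refl) (w , u~w , refl) eq))

recolour-range : ∀ {n} {G : Graph n} {c g u k} → RenumbersOnto (InPalette G c u) g k →
  RangePalette G (λ u v → g (c u v)) u k
recolour-range {c = c} {g} {u} r i = mk⇔
  (λ { (w , u~w , refl) → bounded (w , u~w , refl) })
  (λ i<k → let x , (w , u~w , cuw≡x) , gx≡i = onto i<k in w , u~w , trans (cong g cuw≡x) gx≡i)
  where open RenumbersOnto r

module Palettes {n : ℕ} (G : Graph n) where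

  Adj? : ∀ u v → Dec (Adj G u v)
  Adj? u v = adj G u v Bool.≟ true

  neighbours : Fin n → List (Fin n)
  neighbours v = filter (Adj? v) (allFin n)

  ∈-neighbours : ∀ {v w} → w ∈ neighbours v ⇔ Adj G v w
  ∈-neighbours {v} = mk⇔ (λ w∈ → proj₂ (∈-filter⁻ (Adj? v) {xs = allFin n} w∈)) (∈-filter⁺ (Adj? v) {xs = allFin n} (∈-allFin _))

  neighbours-unique : ∀ v → Unique (neighbours v)
  neighbours-unique v = Unique.filter⁺ (Adj? v) (Unique.allFin⁺ n)

  degree≡length-neighbours : ∀ v → degree G v ≡ length (neighbours v)
  degree≡length-neighbours v = count (allFin n)
    where
    count : ∀ xs → sum (map (λ u → if adj G v u then 1 else 0) xs) ≡ length (filter (Adj? v) xs)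
    count [] = refl
    count (x ∷ xs) with adj G v x
    ... | true  = cong suc (count xs)
    ... | false = count xs

  module _ {c : Fin n → Fin n → ℕ} (proper : ProperEdgeColoring G c) where

    palette : Fin n → List ℕ
    palette v = map (c v) (neighbours v)

    ∈-palette : ∀ {v i} → i ∈ palette v ⇔ InPalette G c v i
    ∈-palette {v} = mk⇔
      (λ i∈ → let w , w∈ , i≡cvw = ∈-map⁻ (c v) i∈ in w , to ∈-neighbours w∈ , ≡.sym i≡cvw)
      (λ { (w , v~w , refl) → ∈-map⁺ (c v) (from ∈-neighbours v~w) })

    -- Properness: distinct neighbours receive distinct colours, so the palette
    -- has no repetitions and its size is the degree.
    palette-unique : ∀ v → Unique (palette v)
    palette-unique v = map-unique colour-injective (neighbours-unique v)
      where
      colour-injective : ∀ {w w′} → w ∈ neighbours v → w′ ∈ neighbours v → c v w ≡ c v w′ → w ≡ w′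
      colour-injective {w} {w′} w∈ w′∈ eq with w Fin.≟ w′
      ... | yes w≡w′ = w≡w′
      ... | no w≢w′  = ⊥-elim (proj₂ proper v w w′ (to ∈-neighbours w∈) (to ∈-neighbours w′∈) w≢w′ eq)

    degree≡length-palette : ∀ v → degree G v ≡ length (palette v)
    degree≡length-palette v = trans (degree≡length-neighbours v) (≡.sym (length-map (c v) (neighbours v)))

    degree-≤-colours : ∀ {v j} → (∀ w → Adj G v w → c v w < j) → degree G v ≤ j
    degree-≤-colours {v} {j} below = begin
      degree G v          ≡⟨ degree≡length-palette v ⟩
      length (palette v)  ≤⟨ unique-⊆⇒length-≤ (palette-unique v) palette⊆ ⟩
      length (upTo j)     ≡⟨ length-upTo j ⟩
      j                   ∎
      where
      open ℕ.≤-Reasoning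
      palette⊆ : palette v ⊆ upTo j
      palette⊆ i∈ with to ∈-palette i∈
      ... | w , v~w , refl = ∈-upTo⁺ (below w v~w)

    range⇒degree : ∀ {v k} → RangePalette G c v k → degree G v ≡ k
    range⇒degree {v} {k} rng = ℕ.≤-antisym (degree-≤-colours λ w → range-bound {G = G} {c = c} rng) (begin
      k                   ≡⟨ length-upTo k ⟨
      length (upTo k)     ≤⟨ unique-⊆⇒length-≤ (Unique.upTo⁺ k) upTo⊆ ⟩
      length (palette v)  ≡⟨ degree≡length-palette v ⟨
      degree G v          ∎)
      where
      open ℕ.≤-Reasoning
      upTo⊆ : upTo k ⊆ palette v
      upTo⊆ i∈ = from ∈-palette (from (rng _) (∈-upTo⁻ i∈))

    saturated⇒range : ∀ {v k} → (∀ w → Adj G v w → c v w < k) → degree G v ≡ k → RangePalette G c v k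
    saturated⇒range {v} {k} below deg≡k i = mk⇔ (λ { (w , v~w , refl) → below w v~w }) present
      where
      present : i < k → InPalette G c v i
      present i<k with i ∈? palette v
      ... | yes i∈ = to ∈-palette i∈
      ... | no i∉  = ⊥-elim (ℕ.<-irrefl refl (begin-strict
        k                         ≡⟨ deg≡k ⟨
        degree G v                ≡⟨ degree≡length-palette v ⟩
        length (palette v)        <⟨ ℕ.n<1+n _ ⟩
        length (i ∷ palette v)    ≤⟨ unique-⊆⇒length-≤ (All.¬Any⇒All¬ _ i∉ ∷ palette-unique v) extended⊆ ⟩
        length (upTo k)           ≡⟨ length-upTo k ⟩
        k                         ∎))
        where
        open ℕ.≤-Reasoning
        extended⊆ : (i ∷ palette v) ⊆ upTo k
        extended⊆ (here refl) = ∈-upTo⁺ i<k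
        extended⊆ (there j∈) with to ∈-palette j∈
        ... | w , v~w , refl = ∈-upTo⁺ (below w v~w)

    same-palette⇒same-degree : ∀ {u v} → SamePalette G c u v → degree G u ≡ degree G v
    same-palette⇒same-degree {u} {v} sp = begin
      degree G u           ≡⟨ degree≡length-palette u ⟩
      length (palette u)   ≡⟨ ℕ.≤-antisym (unique-⊆⇒length-≤ (palette-unique u) (transfer sp))
                                         (unique-⊆⇒length-≤ (palette-unique v) (transfer (λ i → ⇔.sym (sp i)))) ⟩
      length (palette v)   ≡⟨ degree≡length-palette v ⟨
      degree G v           ∎
      where
      open ≡-Reasoning
      transfer : ∀ {x y} → SamePalette G c x y → palette x ⊆ palette y
      transfer sp i∈ = from ∈-palette (to (sp _) (to ∈-palette i∈))

module _ {n : ℕ} {G : Graph n} {c : Fin n → Fin n → ℕ} (proper : ProperEdgeColoring G c) where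
  open Palettes G

  uniform-range⇒regular : ∀ {k} → (∀ v → RangePalette G c v k) → Regular G
  uniform-range⇒regular {k} rng = k , λ v → range⇒degree proper (rng v)

  -- ... and, if G has a vertex, Class 1: c uses k = Δ(G) colours,
  -- and a vertex of degree k needs k colours under any proper colouring.
  uniform-range⇒class1 : ∀ {k} → (∀ v → RangePalette G c v k) → Fin n → Class1 G
  uniform-range⇒class1 {k} rng v₀ =
    k , ((c , proper , λ u v → range-bound {G = G} {c = c} (rng u)) , minimal) ,
        ((λ v → ℕ.≤-reflexive (deg v)) , inj₂ (v₀ , deg v₀))
    where
    deg : ∀ v → degree G v ≡ k
    deg v = range⇒degree proper (rng v)
    minimal : ∀ j c′ → ProperEdgeColoring G c′ → UsesColoursBelow G c′ j → k ≤ j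
    minimal j c′ proper′ below = subst (_≤ j) (deg v₀) (degree-≤-colours proper′ (below v₀))

-- Conversely, an optimal colouring of a regular Class 1 graph has all
-- palettes equal to {0, …, Δ-1}: each vertex sees Δ distinct colours below Δ.
regular-class1⇒uniform-range : ∀ {n} {H : Graph n} → Regular H → Class1 H →
  ∃ λ k → ∃ λ c → ProperEdgeColoring H c × (∀ v → RangePalette H c v k)
regular-class1⇒uniform-range {H = H} (r , deg≡r) (k , ((c , proper , below) , _) , (Δ≤k , attained)) =
  k , c , proper , λ v → saturated⇒range proper (below v) (deg≡k v)
  where
  open Palettes H
  deg≡k : ∀ v → degree H v ≡ k
  deg≡k v = from-attained attained
    where
    from-attained : k ≡ 0 ⊎ ∃ (λ w → degree H w ≡ k) → degree H v ≡ k
    from-attained (inj₁ refl)           = ℕ.n≤0⇒n≡0 (Δ≤k v)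
    from-attained (inj₂ (w , deg-w≡k)) = trans (deg≡r v) (trans (≡.sym (deg≡r w)) deg-w≡k)

Fin1-unique : ∀ (x y : Fin 1) → x ≡ y
Fin1-unique Fin.zero Fin.zero = refl

uniform-palette⇒regular : ∀ {n} {G : Graph n} {c} → ProperEdgeColoring G c →
  (∀ u v → SamePalette G c u v) → Regular G
uniform-palette⇒regular {zero}      _      _    = 0 , λ ()
uniform-palette⇒regular {suc _} {G} proper same =
  degree G Fin.zero , λ v → Palettes.same-palette⇒same-degree G proper (same v Fin.zero)

non-regular⇒two-palettes : ∀ {n} {G : Graph n} {c j} → ¬ Regular G → ProperEdgeColoring G c →
  HasPaletteCount G c j → 2 ≤ j
non-regular⇒two-palettes {G = G} {c} {0} ¬reg proper (f , _) =
  ⊥-elim (¬reg (uniform-palette⇒regular {G = G} {c} proper λ u _ → ⊥-elim (Fin.¬Fin0 (f u))))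
non-regular⇒two-palettes {G = G} {c} {1} ¬reg proper (f , _ , fibres) =
  ⊥-elim (¬reg (uniform-palette⇒regular {G = G} {c} proper λ u v → to (fibres u v) (Fin1-unique (f u) (f v))))
non-regular⇒two-palettes {j = suc (suc _)} _ _ _ = s≤s (s≤s z≤n)

range-labelling⇒count : ∀ {n k} {G : Graph n} {c} (f : Fin n → Fin k) → Surjective _≡_ _≡_ f →
  (K : Fin k → ℕ) → Injective _≡_ _≡_ K → (∀ v → RangePalette G c v (K (f v))) → HasPaletteCount G c k
range-labelling⇒count {G = G} {c} f f-onto K K-inj rng = f , f-onto , λ u v →
  mk⇔ (λ fu≡fv → from (range-palettes-same⇔ {G = G} {c} (rng u) (rng v)) (cong K fu≡fv))
      (λ same → K-inj (to (range-palettes-same⇔ {G = G} {c} (rng u) (rng v)) same))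

other : Fin 2 → Fin 2
other Fin.zero    = Fin.suc Fin.zero
other (Fin.suc _) = Fin.zero

≢⇒other : ∀ {x ℓ : Fin 2} → x ≢ ℓ → x ≡ other ℓ
≢⇒other {Fin.zero}          {Fin.zero}          x≢ℓ = ⊥-elim (x≢ℓ refl)
≢⇒other {Fin.zero}          {Fin.suc Fin.zero}  _   = refl
≢⇒other {Fin.suc Fin.zero}  {Fin.zero}          _   = refl
≢⇒other {Fin.suc Fin.zero}  {Fin.suc Fin.zero}  x≢ℓ = ⊥-elim (x≢ℓ refl)

-- In a non-regular graph, a colouring whose palettes are ranges K (f v),
-- with only two possible labels f v, has exactly two palettes: if f missed
-- a label or K identified the labels, all palettes would be one range.
two-ranges⇒two-palettes : ∀ {n} {G : Graph n} {c} → ¬ Regular G → ProperEdgeColoring G c →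
  (f : Fin n → Fin 2) (K : Fin 2 → ℕ) → (∀ v → RangePalette G c v (K (f v))) → HasPaletteCount G c 2
two-ranges⇒two-palettes {G = G} {c} ¬reg proper f K rng = range-labelling⇒count {G = G} {c} f f-onto K K-injective rng
  where
  one-range : ∀ {k} → (∀ v → K (f v) ≡ k) → Regular G
  one-range Kf≡k = uniform-range⇒regular {G = G} {c} proper (λ v → subst (RangePalette G c v) (Kf≡k v) (rng v))

  f-onto : Surjective _≡_ _≡_ f
  f-onto ℓ with Fin.any? (λ v → f v Fin.≟ ℓ)
  ... | yes (v , fv≡ℓ) = v , λ { refl → fv≡ℓ }
  ... | no missed      = ⊥-elim (¬reg (one-range λ v → cong K (≢⇒other λ fv≡ℓ → missed (v , fv≡ℓ))))

  K-injective : Injective _≡_ _≡_ K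
  K-injective {x} {y} Kx≡Ky with x Fin.≟ y
  ... | yes x≡y = x≡y
  ... | no x≢y  = ⊥-elim (¬reg (one-range {K x} λ v → either (f v Fin.≟ x)))
    where
    either : ∀ {z} → Dec (z ≡ x) → K z ≡ K x
    either (yes refl) = refl
    either {z} (no z≢x) = begin
      K z          ≡⟨ cong K (≢⇒other z≢x) ⟩
      K (other x)  ≡⟨ cong K (≢⇒other λ y≡x → x≢y (≡.sym y≡x)) ⟨
      K y          ≡⟨ Kx≡Ky ⟨
      K x          ∎
      where open ≡-Reasoning

Class1Decomposition : ∀ {n} → Graph n → Set
Class1Decomposition {n} G = ∃ λ m → Σ (Graph m) λ H₁ → Σ (Graph n) λ H₂ → Σ (Fin m → Fin n) λ ι →
  Injective _≡_ _≡_ ι × Regular H₁ × Class1 H₁ × Regular H₂ × Class1 H₂ × IsEdgeDisjointUnion G H₁ ι H₂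

module UnionColouring
  {n m : ℕ} (G : Graph n) (H₁ : Graph m) (H₂ : Graph n) (ι : Fin m → Fin n)
  (ι-injective : Injective _≡_ _≡_ ι)
  (disjoint : ∀ a b → Adj H₁ a b → adj H₂ (ι a) (ι b) ≡ false)
  (union : ∀ u v → Adj G u v ⇔ ((∃ λ a → ∃ λ b → ι a ≡ u × ι b ≡ v × Adj H₁ a b) ⊎ Adj H₂ u v))
  {k₁ : ℕ} {c₁ : Fin m → Fin m → ℕ} (proper₁ : ProperEdgeColoring H₁ c₁) (range₁ : ∀ a → RangePalette H₁ c₁ a k₁)
  {k₂ : ℕ} {c₂ : Fin n → Fin n → ℕ} (proper₂ : ProperEdgeColoring H₂ c₂) (range₂ : ∀ u → RangePalette H₂ c₂ u k₂)
  where

  InImage : Fin n → Set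
  InImage u = ∃ λ a → ι a ≡ u

  in-image? : ∀ u → Dec (InImage u)
  in-image? u = Fin.any? (λ a → ι a Fin.≟ u)

  shifted : ∀ {u v} → Dec (InImage u) → Dec (InImage v) → ℕ
  shifted (yes (a , _)) (yes (b , _)) = k₂ + c₁ a b
  shifted _             _             = 0

  colour : Fin n → Fin n → ℕ
  colour u v = if adj H₂ u v then c₂ u v else shifted (in-image? u) (in-image? v)

  colour-H₂ : ∀ {u v} → Adj H₂ u v → colour u v ≡ c₂ u v
  colour-H₂ u~v rewrite u~v = refl

  colour-H₁ : ∀ {a b} → Adj H₁ a b → colour (ι a) (ι b) ≡ k₂ + c₁ a b
  colour-H₁ {a} {b} a~b rewrite disjoint a b a~b = shifted-images
    where
    shifted-images : shifted (in-image? (ι a)) (in-image? (ι b)) ≡ k₂ + c₁ a b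
    shifted-images with in-image? (ι a) | in-image? (ι b)
    ... | yes (a′ , ιa′≡ιa) | yes (b′ , ιb′≡ιb) rewrite ι-injective ιa′≡ιa | ι-injective ιb′≡ιb = refl
    ... | no a∉    | _        = ⊥-elim (a∉ (a , refl))
    ... | yes _    | no b∉    = ⊥-elim (b∉ (b , refl))

  -- H₂-colours stay below k₂, shifted H₁-colours lie at or above k₂.
  H₂≢H₁ : ∀ {u v a b} → Adj H₂ u v → Adj H₁ a b → colour u v ≢ colour (ι a) (ι b)
  H₂≢H₁ {u} {v} {a} {b} u~v a~b eq = ℕ.<-irrefl refl (ℕ.<-≤-trans below k₂≤)
    where
    below : colour u v < k₂
    below = subst (_< k₂) (≡.sym (colour-H₂ u~v)) (range-bound {G = H₂} {c = c₂} (range₂ u) u~v)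
    k₂≤ : k₂ ≤ colour u v
    k₂≤ = subst (k₂ ≤_) (≡.sym (trans eq (colour-H₁ a~b))) (ℕ.m≤m+n k₂ _)

  proper : ProperEdgeColoring G colour
  proper = symmetric , distinct
    where
    symmetric : ∀ u v → Adj G u v → colour u v ≡ colour v u
    symmetric u v u~v with to (union u v) u~v
    ... | inj₂ u~₂v = begin
      colour u v  ≡⟨ colour-H₂ u~₂v ⟩
      c₂ u v      ≡⟨ proj₁ proper₂ u v u~₂v ⟩
      c₂ v u      ≡⟨ colour-H₂ (Adj-sym H₂ u~₂v) ⟨
      colour v u  ∎
      where open ≡-Reasoning
    ... | inj₁ (a , b , refl , refl , a~b) = begin
      colour (ι a) (ι b)  ≡⟨ colour-H₁ a~b ⟩
      k₂ + c₁ a b         ≡⟨ cong (k₂ +_) (proj₁ proper₁ a b a~b) ⟩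
      k₂ + c₁ b a         ≡⟨ colour-H₁ (Adj-sym H₁ a~b) ⟨
      colour (ι b) (ι a)  ∎
      where open ≡-Reasoning

    distinct : ∀ u v w → Adj G u v → Adj G u w → v ≢ w → colour u v ≢ colour u w
    distinct u v w u~v u~w v≢w with to (union u v) u~v | to (union u w) u~w
    ... | inj₂ u~₂v | inj₂ u~₂w = λ eq →
      proj₂ proper₂ u v w u~₂v u~₂w v≢w (trans (≡.sym (colour-H₂ u~₂v)) (trans eq (colour-H₂ u~₂w)))
    ... | inj₂ u~₂v | inj₁ (_ , _ , refl , refl , a~b) = H₂≢H₁ u~₂v a~b
    ... | inj₁ (_ , _ , refl , refl , a~b) | inj₂ u~₂w = λ eq → H₂≢H₁ u~₂w a~b (≡.sym eq)
    ... | inj₁ (a , b , refl , refl , a~b) | inj₁ (a′ , b′ , ιa′≡ιa , refl , a′~b′) with ι-injective ιa′≡ιa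
    ... | refl = λ eq → proj₂ proper₁ a b b′ a~b a′~b′ (λ { refl → v≢w refl })
                   (ℕ.+-cancelˡ-≡ k₂ _ _ (trans (≡.sym (colour-H₁ a~b)) (trans eq (colour-H₁ a′~b′))))

  range-image : ∀ a → RangePalette G colour (ι a) (k₂ + k₁)
  range-image a i = mk⇔ bounded reached
    where
    bounded : InPalette G colour (ι a) i → i < k₂ + k₁
    bounded (w , a~w , refl) with to (union (ι a) w) a~w
    ... | inj₂ a~₂w = subst (_< k₂ + k₁) (≡.sym (colour-H₂ a~₂w))
                        (ℕ.<-≤-trans (range-bound {G = H₂} {c = c₂} (range₂ (ι a)) a~₂w) (ℕ.m≤m+n k₂ k₁))
    ... | inj₁ (a′ , b , ιa′≡ιa , refl , a′~b) with ι-injective ιa′≡ιa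
    ... | refl = subst (_< k₂ + k₁) (≡.sym (colour-H₁ a′~b))
                   (ℕ.+-monoʳ-< k₂ (range-bound {G = H₁} {c = c₁} (range₁ a′) a′~b))

    reached : i < k₂ + k₁ → InPalette G colour (ι a) i
    reached i< with i ℕ.<? k₂
    ... | yes i<k₂ = let w , a~₂w , c₂≡i = from (range₂ (ι a) i) i<k₂
                     in w , from (union _ _) (inj₂ a~₂w) , trans (colour-H₂ a~₂w) c₂≡i
    ... | no i≮k₂  = let k₂≤i = ℕ.≮⇒≥ i≮k₂
                         b , a~b , c₁≡ = from (range₁ a (i ∸ k₂)) (offset-< k₂≤i i<)
                     in ι b , from (union _ _) (inj₁ (a , b , refl , refl , a~b)) ,
                        trans (colour-H₁ a~b) (trans (cong (k₂ +_) c₁≡) (ℕ.m+[n∸m]≡n k₂≤i))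

  -- A vertex outside the image of ι has only H₂-edges.
  range-outside : ∀ {u} → ¬ InImage u → RangePalette G colour u k₂
  range-outside {u} u∉ i = mk⇔ bounded reached
    where
    bounded : InPalette G colour u i → i < k₂
    bounded (w , u~w , refl) with to (union u w) u~w
    ... | inj₂ u~₂w = subst (_< k₂) (≡.sym (colour-H₂ u~₂w)) (range-bound {G = H₂} {c = c₂} (range₂ u) u~₂w)
    ... | inj₁ (a , _ , ιa≡u , _) = ⊥-elim (u∉ (a , ιa≡u))

    reached : i < k₂ → InPalette G colour u i
    reached i<k₂ = let w , u~₂w , c₂≡i = from (range₂ u i) i<k₂
                   in w , from (union _ _) (inj₂ u~₂w) , trans (colour-H₂ u~₂w) c₂≡i

  side-of : ∀ {u} → Dec (InImage u) → Fin 2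
  side-of (yes _) = Fin.suc Fin.zero
  side-of (no _)  = Fin.zero

  side : Fin n → Fin 2
  side u = side-of (in-image? u)

  side-range : Fin 2 → ℕ
  side-range Fin.zero    = k₂
  side-range (Fin.suc _) = k₂ + k₁

  range-side : ∀ u → RangePalette G colour u (side-range (side u))
  range-side u = by-side (in-image? u)
    where
    by-side : (d : Dec (InImage u)) → RangePalette G colour u (side-range (side-of d))
    by-side (yes (a , refl)) = range-image a
    by-side (no u∉)          = range-outside u∉

  two-palettes : ¬ Regular G → HasPaletteCount G colour 2
  two-palettes ¬reg = two-ranges⇒two-palettes {G = G} {colour} ¬reg proper side side-range range-side

decomposition⇒two-palettes : ∀ {n} {G : Graph n} → ¬ Regular G → Class1Decomposition G →
  ∃ λ c → ProperEdgeColoring G c × HasPaletteCount G c 2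
decomposition⇒two-palettes {G = G} ¬reg (_ , H₁ , H₂ , ι , ι-inj , reg₁ , class₁ , reg₂ , class₂ , disjoint , union)
  with regular-class1⇒uniform-range {H = H₁} reg₁ class₁ | regular-class1⇒uniform-range {H = H₂} reg₂ class₂
... | _ , _ , proper₁ , range₁ | _ , _ , proper₂ , range₂ =
  colour , proper , two-palettes ¬reg
  where open UnionColouring G H₁ H₂ ι ι-inj disjoint union proper₁ range₁ proper₂ range₂

-- Renumber the common colours C = P₀ ∩ P₁ as 0, …, |C|-1, and continue from
-- |C| with the private colours A = P₀ ∖ P₁ and, separately, B = P₁ ∖ P₀.
-- Afterwards every palette is a range: {0, …, |C|+|A|-1} or {0, …, |C|+|B|-1}.
module Normalise {n : ℕ} (G : Graph n) {c : Fin n → Fin n → ℕ} (proper : ProperEdgeColoring G c)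
  (f : Fin n → Fin 2) (classes : ∀ u v → (f u ≡ f v) ⇔ SamePalette G c u v)
  (v₀ v₁ : Fin n) (f-v₀ : f v₀ ≡ Fin.zero) (f-v₁ : f v₁ ≡ Fin.suc Fin.zero) where

  open Palettes G using (palette; palette-unique; ∈-palette)

  P₀ P₁ C A B : List ℕ
  P₀ = palette proper v₀
  P₁ = palette proper v₁
  C  = filter (_∈? P₁) P₀
  A  = filter (λ x → ¬? (x ∈? P₁)) P₀
  B  = filter (λ x → ¬? (x ∈? P₀)) P₁

  P₀-split : ∀ x → x ∈ P₀ ⇔ (x ∈ C ⊎ x ∈ A)
  P₀-split x = mk⇔ split join
    where
    split : x ∈ P₀ → x ∈ C ⊎ x ∈ A
    split x∈P₀ with x ∈? P₁
    ... | yes x∈P₁ = inj₁ (∈-filter⁺ (_∈? P₁) x∈P₀ x∈P₁)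
    ... | no x∉P₁  = inj₂ (∈-filter⁺ (λ x → ¬? (x ∈? P₁)) x∈P₀ x∉P₁)
    join : x ∈ C ⊎ x ∈ A → x ∈ P₀
    join (inj₁ x∈C) = proj₁ (∈-filter⁻ (_∈? P₁) {xs = P₀} x∈C)
    join (inj₂ x∈A) = proj₁ (∈-filter⁻ (λ x → ¬? (x ∈? P₁)) {xs = P₀} x∈A)

  P₁-split : ∀ x → x ∈ P₁ ⇔ (x ∈ C ⊎ x ∈ B)
  P₁-split x = mk⇔ split join
    where
    split : x ∈ P₁ → x ∈ C ⊎ x ∈ B
    split x∈P₁ with x ∈? P₀
    ... | yes x∈P₀ = inj₁ (∈-filter⁺ (_∈? P₁) x∈P₀ x∈P₁)
    ... | no x∉P₀  = inj₂ (∈-filter⁺ (λ x → ¬? (x ∈? P₀)) x∈P₁ x∉P₀)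
    join : x ∈ C ⊎ x ∈ B → x ∈ P₁
    join (inj₁ x∈C) = proj₂ (∈-filter⁻ (_∈? P₁) {xs = P₀} x∈C)
    join (inj₂ x∈B) = proj₁ (∈-filter⁻ (λ x → ¬? (x ∈? P₀)) {xs = P₁} x∈B)

  renumber : ℕ → ℕ
  renumber x with x ∈? P₀ | x ∈? P₁
  ... | yes _ | yes _ = rank x C
  ... | yes _ | no _  = length C + rank x A
  ... | no _  | _     = length C + rank x B

  renumber-C : ∀ {x} → x ∈ C → renumber x ≡ rank x C
  renumber-C {x} x∈C with x ∈? P₀ | x ∈? P₁
  ... | yes _    | yes _    = refl
  ... | yes _    | no x∉P₁  = ⊥-elim (x∉P₁ (proj₂ (∈-filter⁻ (_∈? P₁) {xs = P₀} x∈C)))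
  ... | no x∉P₀  | _        = ⊥-elim (x∉P₀ (proj₁ (∈-filter⁻ (_∈? P₁) {xs = P₀} x∈C)))

  renumber-A : ∀ {x} → x ∈ A → renumber x ≡ length C + rank x A
  renumber-A {x} x∈A with x ∈? P₀ | x ∈? P₁
  ... | yes _    | yes x∈P₁ = ⊥-elim (proj₂ (∈-filter⁻ (λ x → ¬? (x ∈? P₁)) {xs = P₀} x∈A) x∈P₁)
  ... | yes _    | no _     = refl
  ... | no x∉P₀  | _        = ⊥-elim (x∉P₀ (proj₁ (∈-filter⁻ (λ x → ¬? (x ∈? P₁)) {xs = P₀} x∈A)))

  renumber-B : ∀ {x} → x ∈ B → renumber x ≡ length C + rank x B
  renumber-B {x} x∈B with x ∈? P₀ | x ∈? P₁
  ... | yes x∈P₀ | _ = ⊥-elim (proj₂ (∈-filter⁻ (λ x → ¬? (x ∈? P₀)) {xs = P₁} x∈B) x∈P₀)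
  ... | no _     | _ = refl

  representative : Fin 2 → Fin n
  representative Fin.zero    = v₀
  representative (Fin.suc _) = v₁

  size : Fin 2 → ℕ
  size Fin.zero    = length C + length A
  size (Fin.suc _) = length C + length B

  representative-label : ∀ ℓ → f (representative ℓ) ≡ ℓ
  representative-label Fin.zero             = f-v₀
  representative-label (Fin.suc Fin.zero)   = f-v₁

  unique-C : Unique C
  unique-C = Unique.filter⁺ (_∈? P₁) (palette-unique proper v₀)

  renumbers-representative : ∀ ℓ → RenumbersOnto (InPalette G c (representative ℓ)) renumber (size ℓ)
  renumbers-representative Fin.zero = renumbers-resp (λ x → ⇔.trans (⇔.sym (∈-palette proper)) (P₀-split x))
    (two-block-renumbering unique-C (Unique.filter⁺ (λ x → ¬? (x ∈? P₁)) (palette-unique proper v₀)) renumber-C renumber-A)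
  renumbers-representative (Fin.suc Fin.zero) = renumbers-resp (λ x → ⇔.trans (⇔.sym (∈-palette proper)) (P₁-split x))
    (two-block-renumbering unique-C (Unique.filter⁺ (λ x → ¬? (x ∈? P₀)) (palette-unique proper v₁)) renumber-C renumber-B)

  -- Every vertex shares the palette of the representative of its class.
  renumbers-palette : ∀ u → RenumbersOnto (InPalette G c u) renumber (size (f u))
  renumbers-palette u = renumbers-resp (to (classes u (representative (f u))) (≡.sym (representative-label (f u))))
                                       (renumbers-representative (f u))

  normalised : Fin n → Fin n → ℕ
  normalised u v = renumber (c u v)

  normalised-proper : ProperEdgeColoring G normalised
  normalised-proper = recolour-proper {G = G} {c} proper (λ u → RenumbersOnto.injective (renumbers-palette u))

  normalised-range : ∀ u → RangePalette G normalised u (size (f u))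
  normalised-range u = recolour-range {G = G} {c} (renumbers-palette u)

two-palettes⇒two-ranges : ∀ {n} {G : Graph n} {c} → ProperEdgeColoring G c → HasPaletteCount G c 2 →
  ∃ λ d → ∃ λ (f : Fin n → Fin 2) → ∃ λ (K : Fin 2 → ℕ) →
    Surjective _≡_ _≡_ f × ProperEdgeColoring G d × (∀ u → RangePalette G d u (K (f u)))
two-palettes⇒two-ranges {G = G} proper (f , f-onto , classes) =
  normalised , f , size , f-onto , normalised-proper , normalised-range
  where
  open Normalise G proper f classes (proj₁ (f-onto Fin.zero)) (proj₁ (f-onto (Fin.suc Fin.zero)))
                 (proj₂ (f-onto Fin.zero) refl) (proj₂ (f-onto (Fin.suc Fin.zero)) refl)

does-true : ∀ {A : Set} (a? : Dec A) → does a? ≡ true → A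
does-true (yes a) _ = a

module Restrict {n : ℕ} (G : Graph n) {E : Fin n → Fin n → Set} (E? : ∀ u v → Dec (E u v))
  (E-sym : ∀ {u v} → Adj G u v → E u v → E v u) where

  Edge? : ∀ u v → Dec (Adj G u v × E u v)
  Edge? u v = Palettes.Adj? G u v ×-dec E? u v

  flip-edge : ∀ {u v} → Adj G u v × E u v → Adj G v u × E v u
  flip-edge (u~v , e) = Adj-sym G u~v , E-sym u~v e

  no-loop : ∀ {v} → ¬ (Adj G v v × E v v)
  no-loop {v} (v~v , _) with trans (≡.sym (Graph.irrefl G v)) v~v
  ... | ()

  restrict : ∀ {m} → (Fin m → Fin n) → Graph m
  restrict ι = record
    { adj    = λ a b → does (Edge? (ι a) (ι b))
    ; sym    = λ a b → does-≡ (Edge? (ι a) (ι b)) (map′ flip-edge flip-edge (Edge? (ι b) (ι a)))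
    ; irrefl = λ a → dec-false (Edge? (ι a) (ι a)) no-loop }

  restrict-adj : ∀ {m} (ι : Fin m → Fin n) {a b} → Adj (restrict ι) a b ⇔ (Adj G (ι a) (ι b) × E (ι a) (ι b))
  restrict-adj ι {a} {b} = mk⇔ (does-true (Edge? (ι a) (ι b))) (dec-true (Edge? (ι a) (ι b)))

  restrict-proper : ∀ {m} {ι : Fin m → Fin n} {c} → Injective _≡_ _≡_ ι → ProperEdgeColoring G c →
    ProperEdgeColoring (restrict ι) (λ a b → c (ι a) (ι b))
  restrict-proper {ι = ι} ι-inj (symmetric , distinct) =
    (λ a b a~b → symmetric (ι a) (ι b) (proj₁ (to (restrict-adj ι) a~b))) ,
    (λ a b b′ a~b a~b′ b≢b′ → distinct (ι a) (ι b) (ι b′) (proj₁ (to (restrict-adj ι) a~b)) (proj₁ (to (restrict-adj ι) a~b′))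
                                        (λ ιb≡ιb′ → b≢b′ (ι-inj ιb≡ιb′)))

module Split {n : ℕ} (G : Graph n) {d : Fin n → Fin n → ℕ} (proper : ProperEdgeColoring G d)
  (f : Fin n → Fin 2) (f-onto : Surjective _≡_ _≡_ f) (K : Fin 2 → ℕ)
  (range : ∀ u → RangePalette G d u (K (f u)))
  (large : Fin 2) (p<q : K (other large) < K large) where

  p q : ℕ
  p = K (other large)
  q = K large

  Large : Fin n → Set
  Large u = f u ≡ large

  p≤range : ∀ u → p ≤ K (f u)
  p≤range u with f u Fin.≟ large
  ... | yes fu≡large = subst (λ ℓ → p ≤ K ℓ) (≡.sym fu≡large) (ℕ.<⇒≤ p<q)
  ... | no fu≢large  = ℕ.≤-reflexive (cong K (≡.sym (≢⇒other fu≢large)))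

  high⇒large : ∀ {u w} → Adj G u w → p ≤ d u w → Large u
  high⇒large {u} {w} u~w p≤ with f u Fin.≟ large
  ... | yes fu≡large = fu≡large
  ... | no fu≢large  = ⊥-elim (ℕ.<-irrefl refl (ℕ.<-≤-trans duw<p p≤))
    where
    duw<p : d u w < p
    duw<p = subst (d u w <_) (cong K (≢⇒other fu≢large)) (range-bound {G = G} {c = d} (range u) u~w)

  module Low  = Restrict G (λ u v → d u v ℕ.<? p) (λ {u} {v} u~v → subst (_< p) (proj₁ proper u v u~v))
  module High = Restrict G (λ u v → p ℕ.≤? d u v) (λ {u} {v} u~v → subst (p ≤_) (proj₁ proper u v u~v))

  H₂ : Graph n
  H₂ = Low.restrict (λ u → u)

  proper₂ : ProperEdgeColoring H₂ d
  proper₂ = Low.restrict-proper (λ eq → eq) proper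

  range₂ : ∀ u → RangePalette H₂ d u p
  range₂ u i = mk⇔ (λ { (w , u~w , refl) → proj₂ (to (Low.restrict-adj (λ u → u)) u~w) }) reached
    where
    reached : i < p → InPalette H₂ d u i
    reached i<p = let w , u~w , duw≡i = from (range u i) (ℕ.<-≤-trans i<p (p≤range u))
                  in w , from (Low.restrict-adj (λ u → u)) (u~w , subst (_< p) (≡.sym duw≡i) i<p) , duw≡i

  large-vertices : List (Fin n)
  large-vertices = filter (λ u → f u Fin.≟ large) (allFin n)

  ι : Fin (length large-vertices) → Fin n
  ι = lookup large-vertices

  ι-injective : Injective _≡_ _≡_ ι
  ι-injective = lookup-injective (Unique.filter⁺ (λ u → f u Fin.≟ large) (Unique.allFin⁺ n)) _ _

  ι-large : ∀ a → Large (ι a)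
  ι-large a = proj₂ (∈-filter⁻ (λ u → f u Fin.≟ large) {xs = allFin n} (∈-lookup a))

  large⇒image : ∀ {u} → Large u → ∃ λ a → ι a ≡ u
  large⇒image {u} u-large = Any.index u∈ , ≡.sym (lookup-index u∈)
    where
    u∈ : u ∈ large-vertices
    u∈ = ∈-filter⁺ (λ u → f u Fin.≟ large) (∈-allFin u) u-large

  H₁ : Graph (length large-vertices)
  H₁ = High.restrict ι

  inherited : Fin (length large-vertices) → Fin (length large-vertices) → ℕ
  inherited a b = d (ι a) (ι b)

  renumbers₁ : ∀ a → RenumbersOnto (InPalette H₁ inherited a) (_∸ p) (q ∸ p)
  renumbers₁ a = record { bounded = λ s → ℕ.∸-monoˡ-< (below s) (high s) ; injective = injective ; onto = onto }
    where
    high : ∀ {x} → InPalette H₁ inherited a x → p ≤ x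
    high (_ , a~b , refl) = proj₂ (to (High.restrict-adj ι) a~b)

    below : ∀ {x} → InPalette H₁ inherited a x → x < q
    below (b , a~b , refl) = subst (inherited a b <_) (cong K (ι-large a))
                               (range-bound {G = G} {c = d} (range (ι a)) (proj₁ (to (High.restrict-adj ι) a~b)))

    injective : ∀ {x y} → InPalette H₁ inherited a x → InPalette H₁ inherited a y → x ∸ p ≡ y ∸ p → x ≡ y
    injective sx sy eq = trans (≡.sym (ℕ.m∸n+n≡m (high sx))) (trans (cong (_+ p) eq) (ℕ.m∸n+n≡m (high sy)))

    onto : ∀ {i} → i < q ∸ p → ∃ λ x → InPalette H₁ inherited a x × x ∸ p ≡ i
    onto {i} i< = let w , a~w , d≡ = from (range (ι a) (i + p)) (subst (λ ℓ → i + p < K ℓ) (≡.sym (ι-large a)) i+p<q)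
                  in i + p , reach a~w d≡ (large⇒image (w-large a~w d≡)) , ℕ.m+n∸n≡m i p
      where
      i+p<q : i + p < q
      i+p<q = subst (i + p <_) (ℕ.m∸n+n≡m (ℕ.<⇒≤ p<q)) (ℕ.+-monoˡ-< p i<)

      p≤i+p : p ≤ i + p
      p≤i+p = ℕ.m≤n+m p i

      w-large : ∀ {w} → Adj G (ι a) w → d (ι a) w ≡ i + p → Large w
      w-large {w} a~w d≡ = high⇒large (Adj-sym G a~w) (subst (p ≤_) (trans (≡.sym d≡) (proj₁ proper _ _ a~w)) p≤i+p)

      reach : ∀ {w} → Adj G (ι a) w → d (ι a) w ≡ i + p → (∃ λ b → ι b ≡ w) → InPalette H₁ inherited a (i + p)
      reach a~w d≡ (b , refl) = b , from (High.restrict-adj ι) (a~w , subst (p ≤_) (≡.sym d≡) p≤i+p) , d≡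

  proper₁ : ProperEdgeColoring H₁ (λ a b → inherited a b ∸ p)
  proper₁ = recolour-proper {G = H₁} {inherited} (High.restrict-proper ι-injective proper)
                            (λ a → RenumbersOnto.injective (renumbers₁ a))

  range₁ : ∀ a → RangePalette H₁ (λ a b → inherited a b ∸ p) a (q ∸ p)
  range₁ a = recolour-range {G = H₁} {inherited} (renumbers₁ a)

  disjoint : ∀ a b → Adj H₁ a b → adj H₂ (ι a) (ι b) ≡ false
  disjoint a b a~b = dec-false (Low.Edge? (ι a) (ι b))
    λ (_ , low) → ℕ.<-irrefl refl (ℕ.<-≤-trans low (proj₂ (to (High.restrict-adj ι) a~b)))

  union : ∀ u v → Adj G u v ⇔ ((∃ λ a → ∃ λ b → ι a ≡ u × ι b ≡ v × Adj H₁ a b) ⊎ Adj H₂ u v)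
  union u v = mk⇔ classify forget
    where
    -- both ends of a high edge are large, hence images of ι
    classify-high : Adj G u v → p ≤ d u v → ∃ λ a → ∃ λ b → ι a ≡ u × ι b ≡ v × Adj H₁ a b
    classify-high u~v high
      with large⇒image (high⇒large u~v high)
         | large⇒image (high⇒large (Adj-sym G u~v) (subst (p ≤_) (proj₁ proper u v u~v) high))
    ... | a , refl | b , refl = a , b , refl , refl , from (High.restrict-adj ι) (u~v , high)

    classify : Adj G u v → (∃ λ a → ∃ λ b → ι a ≡ u × ι b ≡ v × Adj H₁ a b) ⊎ Adj H₂ u v
    classify u~v with d u v ℕ.<? p
    ... | yes low = inj₂ (from (Low.restrict-adj (λ u → u)) (u~v , low))
    ... | no ¬low = inj₁ (classify-high u~v (ℕ.≮⇒≥ ¬low))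

    forget : (∃ λ a → ∃ λ b → ι a ≡ u × ι b ≡ v × Adj H₁ a b) ⊎ Adj H₂ u v → Adj G u v
    forget (inj₁ (_ , _ , refl , refl , a~b)) = proj₁ (to (High.restrict-adj ι) a~b)
    forget (inj₂ u~₂v)                        = proj₁ (to (Low.restrict-adj (λ u → u)) u~₂v)

  decomposition : Class1Decomposition G
  decomposition =
    length large-vertices , H₁ , H₂ , ι , ι-injective ,
    uniform-range⇒regular {G = H₁} proper₁ range₁ , uniform-range⇒class1 {G = H₁} proper₁ range₁ a₀ ,
    uniform-range⇒regular {G = H₂} proper₂ range₂ , uniform-range⇒class1 {G = H₂} proper₂ range₂ (ι a₀) ,
    disjoint , union
    where
    -- a large vertex exists since f is onto
    a₀ : Fin (length large-vertices)
    a₀ = proj₁ (large⇒image (proj₂ (f-onto large) refl))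

palette-index-2⇒decomposition : ∀ {n} {G : Graph n} → PaletteIndex G 2 → ¬ Regular G × Class1Decomposition G
palette-index-2⇒decomposition {n} {G} ((c , proper , count) , minimal)
  with two-palettes⇒two-ranges {G = G} {c} proper count
... | d , f , K , f-onto , proper-d , range = ¬regular , split (ℕ.<-cmp (K Fin.zero) (K (Fin.suc Fin.zero)))
  where
  v₀ v₁ : Fin n
  v₀ = proj₁ (f-onto Fin.zero)
  v₁ = proj₁ (f-onto (Fin.suc Fin.zero))

  range-at : ∀ {v ℓ} → f v ≡ ℓ → RangePalette G d v (K ℓ)
  range-at {v} refl = range v

  -- Equal ranges would give a colouring with a single palette, against minimality.
  ranges-differ : K Fin.zero ≢ K (Fin.suc Fin.zero)
  ranges-differ eq = ℕ.<-irrefl refl (minimal d 1 proper-d one-palette)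
    where
    K-constant : ∀ ℓ → K ℓ ≡ K Fin.zero
    K-constant Fin.zero           = refl
    K-constant (Fin.suc Fin.zero) = ≡.sym eq
    one-palette : HasPaletteCount G d 1
    one-palette = range-labelling⇒count {G = G} {d} (λ _ → Fin.zero) (λ { Fin.zero → v₀ , λ _ → refl ; (Fin.suc ()) })
                    (λ _ → K Fin.zero) (λ {x} {y} _ → Fin1-unique x y)
                    (λ v → subst (RangePalette G d v) (K-constant (f v)) (range v))

  -- In a regular graph the two ranges, being degrees, would agree.
  ¬regular : ¬ Regular G
  ¬regular (r , deg≡r) = ranges-differ (begin
    K Fin.zero            ≡⟨ Palettes.range⇒degree G proper-d (range-at (proj₂ (f-onto Fin.zero) refl)) ⟨
    degree G v₀           ≡⟨ trans (deg≡r v₀) (≡.sym (deg≡r v₁)) ⟩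
    degree G v₁           ≡⟨ Palettes.range⇒degree G proper-d (range-at (proj₂ (f-onto (Fin.suc Fin.zero)) refl)) ⟩
    K (Fin.suc Fin.zero)  ∎)
    where open ≡-Reasoning

  split : Tri (K Fin.zero < K (Fin.suc Fin.zero)) _ _ → Class1Decomposition G
  split (tri< 0<1 _ _) = Split.decomposition G proper-d f f-onto K range (Fin.suc Fin.zero) 0<1
  split (tri≈ _ eq _)  = ⊥-elim (ranges-differ eq)
  split (tri> _ _ 1<0) = Split.decomposition G proper-d f f-onto K range Fin.zero 1<0

proposition5p2 : (n : ℕ) (G : Graph n) →
    PaletteIndex G 2 ⇔
      (¬ Regular G ×
        ∃ λ m → Σ (Graph m) λ H₁ → Σ (Graph n) λ H₂ → Σ (Fin m → Fin n) λ ι →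
          Injective _≡_ _≡_ ι ×
          Regular H₁ × Class1 H₁ × Regular H₂ × Class1 H₂ ×
          IsEdgeDisjointUnion G H₁ ι H₂)
proposition5p2 n G = mk⇔ (palette-index-2⇒decomposition {G = G}) decomposition⇒palette-index-2
  where
  -- the two-palette colouring is optimal, since non-regular graphs need two palettes
  decomposition⇒palette-index-2 : ¬ Regular G × Class1Decomposition G → PaletteIndex G 2
  decomposition⇒palette-index-2 (¬reg , decomposition) =
    decomposition⇒two-palettes {G = G} ¬reg decomposition ,
    λ c j proper count → non-regular⇒two-palettes {G = G} {c} ¬reg proper count
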